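{- Let $n\ge 3$ and let $S\in\mathcal{S}_{1,2,\overline{4},7}\cup\mathcal{S}_{1,3,\overline{4},7}\cup\mathcal{S}_{1,3,\overline{5},6}$. Then the cycle $C_n$ is $\chi_S$-critical if and only if $n\not\equiv 0\pmod 8$ and $n\ne 4$.
   Context: A packing sequence is a non-decreasing infinite sequence $S=(s_1,s_2,\ldots)$ of positive integers. For a graph $G$, a map $\phi\colon V(G)\to\{1,\ldots,k\}$ is an $S$-packing $k$-coloring if any two distinct vertices $u,v$ with $\phi(u)=\phi(v)=i$ satisfy $d_G(u,v) > s_i$; $\chi_S(G)$ is the least such $k$. A graph $G$ is $\chi_S$-critical if $\chi_S(H)<\chi_S(G)$ for every proper subgraph $H$ of $G$. Notation: $\mathcal{S}_{a_1,a_2,\overline{a_3},a_4}$ is the set of packing sequences with $s_1=a_1$, $s_2=a_2$, $a_3\le s_3\le a_4$, $s_4=a_4$ (later entries arbitrary subject to being a packing sequence). So $\mathcal{S}_{1,2,\overline{4},7}$: $s_1=1,s_2=2,4\le s_3\le 7,s_4=7$; $\mathcal{S}_{1,3,\overline{4},7}$: $s_1=1,s_2=3,4\le s_3\le7,s_4=7$; $\mathcal{S}_{1,3,\overline{5},6}$: $s_1=1,s_2=3,5\le s_3\le 6,s_4=6$. -}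

module Defs where

open import Data.Nat using (ℕ; zero; suc; _+_; _≤_; _<_; _%_)
open import Data.Nat.Properties using (_≟_)
open import Data.Fin using (Fin; toℕ)
open import Data.Bool using (Bool; true; false; T; _∨_)
open import Data.Product using (Σ; _×_; _,_)
open import Data.Sum using (_⊎_)
open import Relation.Nullary using (¬_)
open import Relation.Nullary.Decidable using (⌊_⌋)
open import Relation.Binary.PropositionalEquality using (_≡_; _≢_)

-- A packing sequence S = (s_1, s_2, ...) is encoded as a function
-- S : ℕ → ℕ with  s_{i+1} = S i  (0-based indexing).
PackingSeq : (ℕ → ℕ) → Set
PackingSeq S = (∀ i → 1 ≤ S i) × (∀ i → S i ≤ S (suc i))

InClasses : (ℕ → ℕ) → Set
InClasses S =
  S 0 ≡ 1 ×
  ( (S 1 ≡ 2 × 4 ≤ S 2 × S 2 ≤ 7 × S 3 ≡ 7)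
  ⊎ (S 1 ≡ 3 × 4 ≤ S 2 × S 2 ≤ 7 × S 3 ≡ 7)
  ⊎ (S 1 ≡ 3 × 5 ≤ S 2 × S 2 ≤ 6 × S 3 ≡ 6) )

record PGraph (n : ℕ) : Set where
  field
    vert : Fin n → Bool
    edge : Fin n → Fin n → Bool
open PGraph public

data Walk {n : ℕ} (G : PGraph n) : Fin n → Fin n → ℕ → Set where
  here : ∀ {u} → T (vert G u) → Walk G u u 0
  step : ∀ {u w v len} → T (edge G u w) → Walk G w v len → Walk G u v (suc len)

-- d_G(u,v) > s  (distance ∞ if no path)
DistGt : ∀ {n} → PGraph n → Fin n → Fin n → ℕ → Set
DistGt G u v s = ∀ len → len ≤ s → ¬ Walk G u v len

-- S-packing k-coloring; color c : Fin k stands for colour (toℕ c + 1),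
-- whose constraint is s_{toℕ c + 1} = S (toℕ c).
PackingColoring : ∀ {n} → (ℕ → ℕ) → PGraph n → ℕ → Set
PackingColoring {n} S G k =
  Σ ((v : Fin n) → T (vert G v) → Fin k) λ φ →
    ∀ u v (hu : T (vert G u)) (hv : T (vert G v)) →
      u ≢ v → φ u hu ≡ φ v hv → DistGt G u v (S (toℕ (φ u hu)))

IsChiS : ∀ {n} → (ℕ → ℕ) → PGraph n → ℕ → Set
IsChiS S G k = PackingColoring S G k × (∀ j → j < k → ¬ PackingColoring S G j)

Subgraph : ∀ {n} → PGraph n → PGraph n → Set
Subgraph {n} H G =
  (∀ v → T (vert H v) → T (vert G v)) ×
  (∀ u v → T (edge H u v) → T (edge G u v) × T (vert H u) × T (vert H v)) ×
  (∀ u v → edge H u v ≡ edge H v u)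

ProperSubgraph : ∀ {n} → PGraph n → PGraph n → Set
ProperSubgraph H G =
  Subgraph H G × ¬ ((∀ v → vert H v ≡ vert G v) × (∀ u v → edge H u v ≡ edge G u v))

Critical : ∀ {n} → (ℕ → ℕ) → PGraph n → Set
Critical {n} S G = ∀ (H : PGraph n) → ProperSubgraph H G →
  ∀ kH kG → IsChiS S H kH → IsChiS S G kG → kH < kG

cycle : (n : ℕ) → PGraph n
cycle zero = record { vert = λ _ → true ; edge = λ _ _ → false }
cycle (suc m) = record
  { vert = λ _ → true
  ; edge = λ u v → ⌊ toℕ v ≟ suc (toℕ u) % suc m ⌋ ∨ ⌊ toℕ u ≟ suc (toℕ v) % suc m ⌋ }

{-# OPTIONS --safe #-}
module Submission where

-- Colour with the ruler sequence 0 1 0 2 0 1 0 3, repeated with period 8: its colour classes are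
-- spread out enough for every S in the three classes.
-- A proper subgraph of C_n lies in the path obtained by cutting C_n at a missing edge, and the
-- ruler sequence along that path uses pathColours n colours (2 for n = 3, 3 for n ≤ 7, 4 beyond);
-- when 8 ∣ n it even wraps around C_n itself.
-- Conversely, read along the cycle a packing colouring of C_n is an n-periodic sequence in which
-- colour c never repeats within distance s_c. Exhaustive searches over such sequences, for the
-- least sequences (1,2,4,7,…) and (1,3,5,6,…) of the classes, show that P_8 needs 4 colours and
-- P_4 needs 3 (so C_n is not critical when 8 ∣ n or n = 4), that C_3, C_5, C_6, C_7 need more than
-- pathColours n colours, and that every 4-colouring of 21 consecutive positions repeats with
-- period 8 in its middle. A 4-colouring of C_n, n ≥ 9, would then have period n mod 8 ≠ 0, which
-- the search rules out as well.

open import Defs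
open import Data.Bool using (Bool; true; false; T; not; _∧_; _∨_)
open import Data.Bool.Properties using (T-∧; T-∨; T-≡; ∨-comm; T?)
open import Data.Empty using (⊥; ⊥-elim)
open import Data.Fin using (Fin; toℕ; fromℕ<; fromℕ) renaming (zero to fzero; suc to fsuc)
open import Data.Fin.Properties using (toℕ-fromℕ<; toℕ-injective; toℕ<n; toℕ-fromℕ; all?; ¬∀⟶∃¬)
  renaming (_≟_ to _≟ᶠ_)
open import Data.List using (List; []; _∷_; applyDownFrom; drop; take; head)
open import Data.List.Properties using () renaming (≡-dec to ≡-decᴸ)
open import Data.Maybe.Properties using (just-injective) renaming (≡-dec to ≡-decᴹ)
open import Data.Nat
open import Data.Nat.DivMod
open import Data.Nat.Divisibility using (_∣_; divides; ∣⇒≤; n∣m*n; m%n≡0⇒n∣m)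
open import Data.Nat.Properties
open import Data.Nat.Tactic.RingSolver using (solve-∀)
open import Data.Product using (∃; ∃₂; _×_; _,_; proj₁; proj₂)
open import Data.Sum using (_⊎_; inj₁; inj₂)
open import Data.Unit using (tt)
open import Function using (_∘_)
open import Function.Bundles using (_⇔_; mk⇔; Equivalence)
open import Relation.Binary.PropositionalEquality
open import Relation.Nullary using (¬_; Dec; does; yes; no)
open import Relation.Nullary.Decidable using (⌊_⌋; dec-true; toWitness; fromWitness; ¬?; _→-dec_; _×-dec_)

T-not-∨ : ∀ {a b} → T (not a ∨ b) → T a → T b
T-not-∨ {true} t _ = t

T-ext : ∀ {a b} → (T a → T b) → (T b → T a) → a ≡ b
T-ext {false} {false} _   _   = refl
T-ext {false} {true}  _   b⇒a = ⊥-elim (b⇒a tt)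
T-ext {true}  {false} a⇒b _   = ⊥-elim (a⇒b tt)
T-ext {true}  {true}  _   _   = refl

allBelow : ℕ → (ℕ → Bool) → Bool
allBelow zero    p = true
allBelow (suc k) p = p k ∧ allBelow k p

allBelow-sound : ∀ {k p c} → T (allBelow k p) → c < k → T (p c)
allBelow-sound {suc k} {p} all c<1+k with m<1+n⇒m<n∨m≡n c<1+k
... | inj₁ c<k  = allBelow-sound {k} (proj₂ (Equivalence.to (T-∧ {p k}) all)) c<k
... | inj₂ refl = proj₁ (Equivalence.to (T-∧ {p k}) all)

first4 : ∀ {P : ℕ → Set} → P 0 → P 1 → P 2 → P 3 → ∀ c → c < 4 → P c
first4 p₀ _  _  _  0 _ = p₀
first4 _  p₁ _  _  1 _ = p₁
first4 _  _  p₂ _  2 _ = p₂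
first4 _  _  _  p₃ 3 _ = p₃
first4 _  _  _  _  (suc (suc (suc (suc _)))) (s≤s (s≤s (s≤s (s≤s ()))))

module Congruence (N : ℕ) .{{_ : NonZero N}} where

  infix 4 _≈_
  _≈_ : ℕ → ℕ → Set
  x ≈ y = x % N ≡ y % N

  ≈-mod : ∀ x → x % N ≈ x
  ≈-mod x = m%n%n≡m%n x N

  ≈-+ : ∀ {x y x′ y′} → x ≈ y → x′ ≈ y′ → x + x′ ≈ y + y′
  ≈-+ {x} {y} {x′} {y′} e e′ = begin
    (x + x′) % N         ≡⟨ %-distribˡ-+ x x′ N ⟩
    (x % N + x′ % N) % N ≡⟨ cong₂ (λ a b → (a + b) % N) e e′ ⟩
    (y % N + y′ % N) % N ≡⟨ %-distribˡ-+ y y′ N ⟨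
    (y + y′) % N         ∎
    where open ≡-Reasoning

  ≈-suc-cancel : ∀ {x y} → suc x ≈ suc y → x ≈ y
  ≈-suc-cancel {x} {y} e = begin
    x % N                ≡⟨ [m+n]%n≡m%n x N ⟨
    (x + N) % N          ≡⟨ cong (_% N) (wrap x) ⟩
    (suc x + pred N) % N ≡⟨ ≈-+ e refl ⟩
    (suc y + pred N) % N ≡⟨ cong (_% N) (wrap y) ⟨
    (y + N) % N          ≡⟨ [m+n]%n≡m%n y N ⟩
    y % N                ∎
    where
    open ≡-Reasoning
    wrap : ∀ z → z + N ≡ suc z + pred N
    wrap z = trans (cong (z +_) (sym (suc-pred N))) (+-suc z (pred N))

  ≈-+-cancelˡ : ∀ z {x y} → z + x ≈ z + y → x ≈ y
  ≈-+-cancelˡ zero    e = e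
  ≈-+-cancelˡ (suc z) e = ≈-+-cancelˡ z (≈-suc-cancel e)

  ≈-<-injective : ∀ {x y} → x < N → y < N → x ≈ y → x ≡ y
  ≈-<-injective x<N y<N e = trans (sym (m<n⇒m%n≡m x<N)) (trans e (m<n⇒m%n≡m y<N))

toℕ-mod : ∀ i n .{{_ : NonZero n}} → toℕ (i mod n) ≡ i % n
toℕ-mod i n = toℕ-fromℕ< (m%n<n i n)

mod-distinct : ∀ n .{{_ : NonZero n}} i d → 0 < d → d < n → i mod n ≢ (i + d) mod n
mod-distinct n i d 0<d d<n same = <-irrefl (sym d≡0) 0<d
  where
  open Congruence n
  i≈i+d : i + 0 ≈ i + d
  i≈i+d = trans (cong (_% n) (+-identityʳ i))
                (trans (sym (toℕ-mod i n)) (trans (cong toℕ same) (toℕ-mod (i + d) n)))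
  d≡0 : d ≡ 0
  d≡0 = sym (≈-<-injective (≤-<-trans z≤n d<n) d<n (≈-+-cancelˡ i i≈i+d))

mod-+-period : ∀ n .{{_ : NonZero n}} i → (i + n) mod n ≡ i mod n
mod-+-period n i = toℕ-injective (begin
  toℕ ((i + n) mod n) ≡⟨ toℕ-mod (i + n) n ⟩
  (i + n) % n         ≡⟨ [m+n]%n≡m%n i n ⟩
  i % n               ≡⟨ toℕ-mod i n ⟨
  toℕ (i mod n)       ∎)
  where open ≡-Reasoning

-- What an L-packing colouring leaves visible along the positions below B of a walk whose vertices
-- at most D steps apart are distinct.
Separated : (L : ℕ → ℕ) (D B : ℕ) → (ℕ → ℕ) → Set
Separated L D B f = ∀ i d → 0 < d → d ≤ D → i + d < B → f i ≡ f (i + d) → L (f i) < d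

separated-shift : ∀ {L D B f} i → Separated L D (i + B) f → Separated L D B (λ e → f (i + e))
separated-shift {B = B} {f} i sep j d 0<d d≤D j+d<B same =
  sep (i + j) d 0<d d≤D (subst (_< i + B) (sym (+-assoc i j d)) (+-monoʳ-< i j+d<B))
      (trans same (cong f (sym (+-assoc i j d))))

-- Words are stored newest colour first (applyDownFrom f l is f 0 … f (l - 1) read backwards), and
-- fitsFrom d c w says that c may follow w when the newest letter of w lies d steps back.
module Search (L : ℕ → ℕ) (D k : ℕ) where

  spaced? : ∀ d c x → Dec (d ≤ D → x ≡ c → L c < d)
  spaced? d c x = (d ≤? D) →-dec (x ≟ c) →-dec (L c <? d)

  fitsFrom : ℕ → ℕ → List ℕ → Bool
  fitsFrom d c []      = true
  fitsFrom d c (x ∷ w) = does (spaced? d c x) ∧ fitsFrom (suc d) c w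

  everyExtension : (List ℕ → Bool) → ℕ → List ℕ → Bool
  everyExtension p zero    w = p w
  everyExtension p (suc m) w = allBelow k λ c → not (fitsFrom 1 c w) ∨ everyExtension p m (c ∷ w)

  module _ {B : ℕ} {f : ℕ → ℕ} (f<k : ∀ j → j < B → f j < k) (sep : Separated L D B f) where

    fitsFrom-applyDownFrom : ∀ {j} d l → j < B → 0 < d → l + d ≡ suc j →
                             T (fitsFrom d (f j) (applyDownFrom f l))
    fitsFrom-applyDownFrom d zero    _   _   _  = tt
    fitsFrom-applyDownFrom {j} d (suc l) j<B 0<d l+d≡1+j =
      Equivalence.from T-∧
        ( Equivalence.from T-≡ (dec-true (spaced? d (f j) (f l)) spaced)
        , fitsFrom-applyDownFrom (suc d) l j<B z<s (trans (+-suc l d) l+d≡1+j))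
      where
      l+d≡j : l + d ≡ j
      l+d≡j = suc-injective l+d≡1+j
      spaced : d ≤ D → f l ≡ f j → L (f j) < d
      spaced d≤D fl≡fj = subst (λ c → L c < d) fl≡fj
        (sep l d 0<d d≤D (subst (_< B) (sym l+d≡j) j<B) (trans fl≡fj (cong f (sym l+d≡j))))

    everyExtension-sound-from : ∀ {p} m l → m + l ≤ B → T (everyExtension p m (applyDownFrom f l)) →
                                T (p (applyDownFrom f (m + l)))
    everyExtension-sound-from     zero    l _  t = t
    everyExtension-sound-from {p} (suc m) l le t =
      subst (λ x → T (p (applyDownFrom f x))) (+-suc m l)
        (everyExtension-sound-from m (suc l) (subst (_≤ B) (sym (+-suc m l)) le)
          (T-not-∨ (allBelow-sound t (f<k l l<B)) (fitsFrom-applyDownFrom 1 l l<B z<s (+-comm l 1))))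
      where
      l<B : l < B
      l<B = <-≤-trans (s≤s (m≤n+m l m)) le

    everyExtension-sound : ∀ {p} → T (everyExtension p B []) → T (p (applyDownFrom f B))
    everyExtension-sound {p} t =
      subst (λ x → T (p (applyDownFrom f x))) (+-identityʳ B)
        (everyExtension-sound-from B 0 (≤-reflexive (+-identityʳ B)) t)

open Search using (everyExtension; everyExtension-sound)

repeatsAt : ℕ → ℕ → List ℕ → Bool
repeatsAt i j w = ⌊ ≡-decᴹ _≟_ (head (drop i w)) (head (drop j w)) ⌋

notSquare : ℕ → List ℕ → Bool
notSquare r w = ⌊ ¬? (≡-decᴸ _≟_ (drop r w) (take r w)) ⌋

noSquare : (L : ℕ → ℕ) (D k r : ℕ) → Bool
noSquare L D k r = everyExtension L D k (notSquare r) (r + r) []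

noWord : (L : ℕ → ℕ) (D k m : ℕ) → Bool
noWord L D k m = everyExtension L D k (λ _ → false) m []

HasPeriod : ℕ → (ℕ → ℕ) → Set
HasPeriod r f = ∀ x → f (x + r) ≡ f x

hasPeriod-* : ∀ {p f} → HasPeriod p f → ∀ q → HasPeriod (q * p) f
hasPeriod-* {p} {f} per zero    x = cong f (+-identityʳ x)
hasPeriod-* {p} {f} per (suc q) x = begin
  f (x + (p + q * p)) ≡⟨ cong f (sym (+-assoc x p (q * p))) ⟩
  f (x + p + q * p)   ≡⟨ hasPeriod-* per q (x + p) ⟩
  f (x + p)           ≡⟨ per x ⟩
  f x                 ∎
  where open ≡-Reasoning

hasPeriod-% : ∀ {p n f} .{{_ : NonZero p}} → HasPeriod p f → HasPeriod n f → HasPeriod (n % p) f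
hasPeriod-% {p} {n} {f} perₚ perₙ x = begin
  f (x + n % p)                 ≡⟨ hasPeriod-* perₚ (n / p) (x + n % p) ⟨
  f (x + n % p + (n / p) * p)   ≡⟨ cong f (+-assoc x (n % p) ((n / p) * p)) ⟩
  f (x + (n % p + (n / p) * p)) ≡⟨ cong (λ y → f (x + y)) (m≡m%n+[m/n]*n n p) ⟨
  f (x + n)                     ≡⟨ perₙ x ⟩
  f x                           ∎
  where open ≡-Reasoning

-- A period c + e of f moves any position beyond c, where the local period p is known.
hasPeriod-from : ∀ {c e p f} → HasPeriod (c + e) f → (∀ i → f (i + c + p) ≡ f (i + c)) → HasPeriod p f
hasPeriod-from {c} {e} {p} {f} per local x = begin
  f (x + p)             ≡⟨ per (x + p) ⟨
  f (x + p + (c + e))   ≡⟨ cong f (shuffle x p c e) ⟩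
  f (x + e + c + p)     ≡⟨ local (x + e) ⟩
  f (x + e + c)         ≡⟨ cong f (regroup x c e) ⟩
  f (x + (c + e))       ≡⟨ per x ⟩
  f x                   ∎
  where
  open ≡-Reasoning
  shuffle : ∀ x p c e → x + p + (c + e) ≡ x + e + c + p
  shuffle = solve-∀
  regroup : ∀ x c e → x + e + c ≡ x + (c + e)
  regroup = solve-∀

drop-applyDownFrom : ∀ (f : ℕ → ℕ) r l → drop r (applyDownFrom f (r + l)) ≡ applyDownFrom f l
drop-applyDownFrom f zero    l = refl
drop-applyDownFrom f (suc r) l = drop-applyDownFrom f r l

take-applyDownFrom : ∀ {f r} → HasPeriod r f → ∀ l → take l (applyDownFrom f (r + l)) ≡ applyDownFrom f l
take-applyDownFrom         per zero    = refl
take-applyDownFrom {f} {r} per (suc l) rewrite +-suc r l =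
  cong₂ _∷_ (trans (cong f (+-comm r l)) (per l)) (take-applyDownFrom per l)

periodic⇒¬noSquare : ∀ {L D k r f} → (∀ j → j < r + r → f j < k) → Separated L D (r + r) f →
                     HasPeriod r f → ¬ T (noSquare L D k r)
periodic⇒¬noSquare {L} {D} {k} {r} {f} f<k sep per noSq =
  toWitness {a? = ¬? (≡-decᴸ _≟_ (drop r w) (take r w))} (everyExtension-sound L D k f<k sep noSq)
    (trans (drop-applyDownFrom f r r) (sym (take-applyDownFrom per r)))
  where
  w : List ℕ
  w = applyDownFrom f (r + r)

walk-subgraph : ∀ {n} {H G : PGraph n} → Subgraph H G → ∀ {u v len} → Walk H u v len → Walk G u v len
walk-subgraph H⊆G (here u∈H)  = here (proj₁ H⊆G _ u∈H)
walk-subgraph H⊆G (step uw w) = step (proj₁ (proj₁ (proj₂ H⊆G) _ _ uw)) (walk-subgraph H⊆G w)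

restrictColouring : ∀ {n S k} {H G : PGraph n} → Subgraph H G → PackingColoring S G k → PackingColoring S H k
restrictColouring H⊆G (φ , packed) =
  (λ v v∈H → φ v (proj₁ H⊆G v v∈H)) ,
  λ u v _ _ u≢v same len len≤s w → packed u v _ _ u≢v same len len≤s (walk-subgraph H⊆G w)

distGt-1 : ∀ {n} {G : PGraph n} {u v} → u ≢ v → ¬ T (edge G u v) → DistGt G u v 1
distGt-1 u≢v _   zero          _        (here _)           = u≢v refl
distGt-1 _   ¬uv (suc zero)    _        (step uv (here _)) = ¬uv uv
distGt-1 _   _   (suc (suc _)) (s≤s ()) _

colourGap⇒critical : ∀ {n S K} {G : PGraph n} → (∀ H → ProperSubgraph H G → PackingColoring S H K) →
                     (∀ k → k ≤ K → ¬ PackingColoring S G k) → Critical S G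
colourGap⇒critical colourH noColouring H H<G kH kG (_ , minimalH) (colourG , _) =
  ≤-<-trans (≮⇒≥ λ K<kH → minimalH _ K<kH (colourH H H<G)) (≰⇒> λ kG≤K → noColouring kG kG≤K colourG)

tightSubgraph⇒¬critical : ∀ {n S k} {H G : PGraph n} → ProperSubgraph H G → PackingColoring S G k →
                          (∀ j → j < k → ¬ PackingColoring S H j) → ¬ Critical S G
tightSubgraph⇒¬critical {S = S} {k} {H} {G} (H⊆G , H≢G) colourG noColouring crit =
  <-irrefl refl (crit H (H⊆G , H≢G) k k (restrict colourG , noColouring)
                  (colourG , λ j j<k colourG′ → noColouring j j<k (restrict colourG′)))
  where
  restrict : ∀ {j} → PackingColoring S G j → PackingColoring S H j
  restrict = restrictColouring {S = S} H⊆G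

cycle-edge⁺ : ∀ {m} (u v : Fin (suc m)) → toℕ v ≡ suc (toℕ u) % suc m ⊎ toℕ u ≡ suc (toℕ v) % suc m →
              T (edge (cycle (suc m)) u v)
cycle-edge⁺ {m} u v (inj₁ fwd) = Equivalence.from (T-∨ {⌊ toℕ v ≟ suc (toℕ u) % suc m ⌋}) (inj₁ (fromWitness fwd))
cycle-edge⁺ {m} u v (inj₂ bwd) = Equivalence.from (T-∨ {⌊ toℕ v ≟ suc (toℕ u) % suc m ⌋}) (inj₂ (fromWitness bwd))

cycle-edge⁻ : ∀ {m} (u v : Fin (suc m)) → T (edge (cycle (suc m)) u v) →
              toℕ v ≡ suc (toℕ u) % suc m ⊎ toℕ u ≡ suc (toℕ v) % suc m
cycle-edge⁻ {m} u v uv with Equivalence.to (T-∨ {⌊ toℕ v ≟ suc (toℕ u) % suc m ⌋}) uv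
... | inj₁ fwd = inj₁ (toWitness fwd)
... | inj₂ bwd = inj₂ (toWitness bwd)

cycle-mod-adjacent : ∀ m i → T (edge (cycle (suc m)) (i mod suc m) (suc i mod suc m))
cycle-mod-adjacent m i = cycle-edge⁺ (i mod suc m) (suc i mod suc m) (inj₁ (begin
  toℕ (suc i mod suc m)           ≡⟨ toℕ-mod (suc i) (suc m) ⟩
  suc i % suc m                   ≡⟨ ≈-+ {1} {1} {i % suc m} {i} refl (≈-mod i) ⟨
  suc (i % suc m) % suc m         ≡⟨ cong (λ x → suc x % suc m) (toℕ-mod i (suc m)) ⟨
  suc (toℕ (i mod suc m)) % suc m ∎))
  where
  open ≡-Reasoning
  open Congruence (suc m)

path : (n : ℕ) → PGraph n
path n = record
  { vert = λ _ → true
  ; edge = λ u v → ⌊ toℕ v ≟ suc (toℕ u) ⌋ ∨ ⌊ toℕ u ≟ suc (toℕ v) ⌋ }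

path⊆cycle : ∀ m → Subgraph (path (suc m)) (cycle (suc m))
path⊆cycle m =
  (λ _ _ → tt) , (λ u v uv → path-edge u v uv , tt , tt) ,
  (λ u v → ∨-comm ⌊ toℕ v ≟ suc (toℕ u) ⌋ ⌊ toℕ u ≟ suc (toℕ v) ⌋)
  where
  no-wrap : ∀ {x y : Fin (suc m)} → toℕ y ≡ suc (toℕ x) → toℕ y ≡ suc (toℕ x) % suc m
  no-wrap {x} {y} e = trans e (sym (m<n⇒m%n≡m (subst (_< suc m) e (toℕ<n y))))
  path-edge : ∀ u v → T (edge (path (suc m)) u v) → T (edge (cycle (suc m)) u v)
  path-edge u v uv with Equivalence.to (T-∨ {⌊ toℕ v ≟ suc (toℕ u) ⌋}) uv
  ... | inj₁ fwd = cycle-edge⁺ u v (inj₁ (no-wrap (toWitness fwd)))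
  ... | inj₂ bwd = cycle-edge⁺ u v (inj₂ (no-wrap (toWitness bwd)))

path-proper : ∀ m → ProperSubgraph (path (3 + m)) (cycle (3 + m))
path-proper m = path⊆cycle (2 + m) , λ (_ , same-edges) → subst T (sym (same-edges last fzero)) closing
  where
  last : Fin (3 + m)
  last = fromℕ (2 + m)
  closing : T (edge (cycle (3 + m)) last fzero)
  closing = cycle-edge⁺ last fzero
    (inj₁ (sym (trans (cong (λ x → suc x % (3 + m)) (toℕ-fromℕ (2 + m))) (n%n≡0 (3 + m)))))

module ColourSequence {n S k} {G : PGraph n} (spanning : ∀ v → T (vert G v)) (col : PackingColoring S G k) where

  colourAlong : (ℕ → Fin n) → ℕ → ℕ
  colourAlong pos i = toℕ (proj₁ col (pos i) (spanning (pos i)))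

  colourAlong<k : ∀ pos i → colourAlong pos i < k
  colourAlong<k pos i = toℕ<n _

  module _ (pos : ℕ → Fin n) {B : ℕ} (adjacent : ∀ i → suc i < B → T (edge G (pos i) (pos (suc i)))) where

    walkAlong : ∀ i d → i + d < B → Walk G (pos i) (pos (i + d)) d
    walkAlong i zero    _     = subst (λ j → Walk G (pos i) (pos j) 0) (sym (+-identityʳ i)) (here (spanning _))
    walkAlong i (suc d) i+d<B =
      step (adjacent i (≤-<-trans (s≤s (m≤m+n i d)) 1+i+d<B))
           (subst (λ j → Walk G (pos (suc i)) (pos j) d) (sym (+-suc i d)) (walkAlong (suc i) d 1+i+d<B))
      where
      1+i+d<B : suc i + d < B
      1+i+d<B = subst (_< B) (+-suc i d) i+d<B

    colourAlong-separated : ∀ {L D} → (∀ c → L c ≤ S c) →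
                            (∀ i d → 0 < d → d ≤ D → i + d < B → pos i ≢ pos (i + d)) →
                            Separated L D B (colourAlong pos)
    colourAlong-separated L≤S distinct i d 0<d d≤D i+d<B same = ≰⇒> λ d≤L →
      proj₂ col (pos i) (pos (i + d)) _ _ (distinct i d 0<d d≤D i+d<B) (toℕ-injective same)
        d (≤-trans d≤L (L≤S _)) (walkAlong i d i+d<B)

module CycleColourSequence {m S k} (col : PackingColoring S (cycle (suc m)) k) where
  open ColourSequence {S = S} (λ _ → tt) col public

  ψ : ℕ → ℕ
  ψ = colourAlong (_mod suc m)

  ψ-periodic : HasPeriod (suc m) ψ
  ψ-periodic i = cong (λ v → toℕ (proj₁ col v tt)) (mod-+-period (suc m) i)

  ψ-separated : ∀ {L D} → (∀ c → L c ≤ S c) → D < suc m → ∀ B → Separated L D B ψ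
  ψ-separated L≤S D<n B = colourAlong-separated (_mod suc m) (λ i _ → cycle-mod-adjacent m i) L≤S
    λ i d 0<d d≤D _ → mod-distinct (suc m) i d 0<d (≤-<-trans d≤D D<n)

rulerDigit : ℕ → ℕ
rulerDigit 0 = 0
rulerDigit 1 = 1
rulerDigit 2 = 0
rulerDigit 3 = 2
rulerDigit 4 = 0
rulerDigit 5 = 1
rulerDigit 6 = 0
rulerDigit _ = 3

-- ruler x is the 2-adic valuation of x + 1, capped at 3.
ruler : ℕ → ℕ
ruler x = rulerDigit (x % 8)

-- Colour c recurs in the ruler sequence only after 2^(c+1) steps (after 8 steps for c = 3).
rulerBound : ℕ → ℕ
rulerBound 0 = 1
rulerBound 1 = 3
rulerBound _ = 7

rulerBound≤7 : ∀ c → rulerBound c ≤ 7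
rulerBound≤7 0             = s≤s z≤n
rulerBound≤7 1             = s≤s (s≤s (s≤s z≤n))
rulerBound≤7 (suc (suc _)) = ≤-refl

ruler<4 : ∀ x → ruler x < 4
ruler<4 x = toWitness {a? = allUpTo? (λ r → rulerDigit r <? 4) 8} tt (m%n<n x 8)

ruler-spacing : ∀ x j → 0 < j → j ≤ 7 → ruler x ≡ ruler (j + x) → rulerBound (ruler x) < j
ruler-spacing x j 0<j j≤7 same =
  onResidues (m%n<n x 8) (s≤s j≤7) 0<j
    (trans same (cong rulerDigit (≈-+ {j} {j} {x} {x % 8} refl (sym (≈-mod x)))))
  where
  open Congruence 8
  onResidues : ∀ {r} → r < 8 → ∀ {j} → j < 8 → 0 < j → rulerDigit r ≡ rulerDigit ((j + r) % 8) →
               rulerBound (rulerDigit r) < j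
  onResidues = toWitness {a? = allUpTo? (λ r → allUpTo? (λ j →
    (0 <? j) →-dec (rulerDigit r ≟ rulerDigit ((j + r) % 8)) →-dec (rulerBound (rulerDigit r) <? j)) 8) 8} tt

-- A labelling by ℤ/N that is injective and moves by ±1 along edges makes G look locally like a
-- cycle of length N; when 8 ∣ N the ruler sequence pulls back to a packing colouring.
module RulerColouring {n} (G : PGraph n) (N : ℕ) .{{_ : NonZero N}} (8∣N : 8 ∣ N) (label : Fin n → ℕ)
  (label-injective : ∀ u v → label u % N ≡ label v % N → u ≡ v)
  (label-edge : ∀ u v → T (edge G u v) → suc (label u) % N ≡ label v % N ⊎ suc (label v) % N ≡ label u % N)
  where

  open Congruence N

  walk-offsets : ∀ {u v len} → Walk G u v len → ∃₂ λ a b → a + b ≤ len × a + label u ≈ b + label v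
  walk-offsets (here _) = 0 , 0 , z≤n , refl
  walk-offsets {u} {v} {suc len} (step {w = w} uw walk) with walk-offsets walk | label-edge u w uw
  ... | a , b , a+b≤len , e | inj₁ fwd =
    suc a , b , s≤s a+b≤len ,
    trans (cong (_% N) (sym (+-suc a (label u)))) (trans (≈-+ {a} {a} refl fwd) e)
  ... | a , b , a+b≤len , e | inj₂ bwd =
    a , suc b , subst (_≤ suc len) (sym (+-suc a b)) (s≤s a+b≤len) ,
    trans (≈-+ {a} {a} refl (sym bwd)) (trans (cong (_% N) (+-suc a (label w))) (≈-+ {1} {1} refl e))

  ordered-shift : ∀ {a b x y} → a ≤ b → a + x ≈ b + y → ∃ λ j → j ≤ b × x ≈ j + y
  ordered-shift {a} {b} {x} {y} a≤b e with m≤n⇒∃[o]m+o≡n a≤b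
  ... | j , a+j≡b = j , ≤-trans (m≤n+m j a) (≤-reflexive a+j≡b) ,
    ≈-+-cancelˡ a (trans e (cong (_% N) (trans (cong (_+ y) (sym a+j≡b)) (+-assoc a j y))))

  ruler-≈ : ∀ {x y} → x ≈ y → ruler x ≡ ruler y
  ruler-≈ {x} {y} e = cong rulerDigit
    (trans (sym (m∣n⇒o%n%m≡o%m 8 N x 8∣N)) (trans (cong (_% 8) e) (m∣n⇒o%n%m≡o%m 8 N y 8∣N)))

  module _ {S : ℕ → ℕ} (S≤bound : ∀ c → c < 4 → S c ≤ rulerBound c) where

    sameRuler-nearby⇒≈ : ∀ {x y j len} → ruler x ≡ ruler y → y ≈ j + x → j ≤ len → len ≤ S (ruler x) → y ≈ x
    sameRuler-nearby⇒≈ {j = zero}        _    y≈x    _     _     = y≈x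
    sameRuler-nearby⇒≈ {x} {y} {suc j} same y≈j+x j≤len len≤S =
      ⊥-elim (<⇒≱ (ruler-spacing x (suc j) z<s (≤-trans j≤bound (rulerBound≤7 _)) (trans same (ruler-≈ y≈j+x)))
                   j≤bound)
      where
      j≤bound : suc j ≤ rulerBound (ruler x)
      j≤bound = ≤-trans j≤len (≤-trans len≤S (S≤bound (ruler x) (ruler<4 x)))

    sameRuler-shortWalk⇒≡ : ∀ {u v len} → ruler (label u) ≡ ruler (label v) → len ≤ S (ruler (label u)) →
                            Walk G u v len → u ≡ v
    sameRuler-shortWalk⇒≡ {u} {v} {len} same len≤S walk with walk-offsets walk
    ... | a , b , a+b≤len , e with ≤-total a b
    ...   | inj₁ a≤b = let j , j≤b , u≈j+v = ordered-shift a≤b e in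
      label-injective u v (sameRuler-nearby⇒≈ (sym same) u≈j+v (≤-trans j≤b (≤-trans (m≤n+m b a) a+b≤len))
                                              (subst (λ c → len ≤ S c) same len≤S))
    ...   | inj₂ b≤a = let j , j≤a , v≈j+u = ordered-shift b≤a (sym e) in
      sym (label-injective v u (sameRuler-nearby⇒≈ same v≈j+u (≤-trans j≤a (≤-trans (m≤m+n a b) a+b≤len)) len≤S))

    rulerColouring : ∀ {K} → (∀ v → ruler (label v) < K) → PackingColoring S G K
    rulerColouring {K} fewColours = colour , λ u v _ _ u≢v same len len≤S walk →
      u≢v (sameRuler-shortWalk⇒≡ (trans (sym (toℕ-fromℕ< _)) (trans (cong toℕ same) (toℕ-fromℕ< _)))
                                  (subst (λ c → len ≤ S c) (toℕ-fromℕ< _) len≤S) walk)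
      where
      colour : (v : Fin n) → T (vert G v) → Fin K
      colour v _ = fromℕ< (fewColours v)

cycle-rulerColouring : ∀ {m S} → (∀ c → c < 4 → S c ≤ rulerBound c) → 8 ∣ suc m →
                       PackingColoring S (cycle (suc m)) 4
cycle-rulerColouring {m} S≤bound 8∣n =
  RulerColouring.rulerColouring (cycle (suc m)) (suc m) 8∣n toℕ injective adjacent S≤bound (ruler<4 ∘ toℕ)
  where
  open Congruence (suc m)
  injective : ∀ u v → toℕ u ≈ toℕ v → u ≡ v
  injective u v e = toℕ-injective (≈-<-injective (toℕ<n u) (toℕ<n v) e)
  reduced : ∀ {x} (v : Fin (suc m)) → toℕ v ≡ x % suc m → x ≈ toℕ v
  reduced v e = trans (sym e) (sym (m<n⇒m%n≡m (toℕ<n v)))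
  adjacent : ∀ u v → T (edge (cycle (suc m)) u v) → suc (toℕ u) ≈ toℕ v ⊎ suc (toℕ v) ≈ toℕ u
  adjacent u v uv with cycle-edge⁻ u v uv
  ... | inj₁ fwd = inj₁ (reduced {suc (toℕ u)} v fwd)
  ... | inj₂ bwd = inj₂ (reduced {suc (toℕ v)} u bwd)

c4 : Fin 4 → Fin 3
c4 fzero                      = fzero
c4 (fsuc fzero)               = fsuc fzero
c4 (fsuc (fsuc fzero))        = fzero
c4 (fsuc (fsuc (fsuc fzero))) = fsuc (fsuc fzero)

c4-classes : ∀ u v → u ≢ v → c4 u ≡ c4 v → c4 u ≡ fzero × ¬ T (edge (cycle 4) u v)
c4-classes = toWitness {a? = all? λ u → all? λ v →
  ¬? (u ≟ᶠ v) →-dec (c4 u ≟ᶠ c4 v) →-dec ((c4 u ≟ᶠ fzero) ×-dec ¬? (T? (edge (cycle 4) u v)))} tt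

c4-colouring : ∀ {S} → S 0 ≡ 1 → PackingColoring S (cycle 4) 3
c4-colouring {S} s₀ = (λ v _ → c4 v) , λ u v _ _ u≢v same →
  let c≡0 , ¬uv = c4-classes u v u≢v same
  in subst (DistGt (cycle 4) u v) (trans (sym s₀) (cong (S ∘ toℕ) (sym c≡0))) (distGt-1 u≢v ¬uv)

pathColours : ℕ → ℕ
pathColours 0 = 2
pathColours 1 = 2
pathColours 2 = 2
pathColours 3 = 2
pathColours 4 = 3
pathColours 5 = 3
pathColours 6 = 3
pathColours 7 = 3
pathColours _ = 4

pathColours-≥8 : ∀ {n} → 8 ≤ n → pathColours n ≡ 4
pathColours-≥8 (s≤s (s≤s (s≤s (s≤s (s≤s (s≤s (s≤s (s≤s _)))))))) = refl

ruler<pathColours : ∀ {x n} → x < n → ruler x < pathColours n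
ruler<pathColours {x} {n} x<n with n <? 8
... | yes n<8 = toWitness {a? = allUpTo? (λ n → allUpTo? (λ x → ruler x <? pathColours n) n) 8} tt n<8 x<n
... | no n≮8  = subst (ruler x <_) (sym (pathColours-≥8 (≮⇒≥ n≮8))) (ruler<4 x)

module Cut (m : ℕ) (a : Fin (suc m)) where
  open Congruence (suc m)

  position : Fin (suc m) → ℕ
  position x = (toℕ x + (m ∸ toℕ a)) % suc m

  position<n : ∀ x → position x < suc m
  position<n x = m%n<n (toℕ x + (m ∸ toℕ a)) (suc m)

  position-a : position a ≡ m
  position-a = trans (cong (_% suc m) (m+[n∸m]≡n (≤-pred (toℕ<n a)))) (m<n⇒m%n≡m ≤-refl)

  position-injective : ∀ {u v} → position u ≡ position v → u ≡ v
  position-injective {u} {v} e = toℕ-injective (≈-<-injective (toℕ<n u) (toℕ<n v)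
    (≈-+-cancelˡ (m ∸ toℕ a) (trans (cong (_% suc m) (+-comm (m ∸ toℕ a) (toℕ u)))
                               (trans e (cong (_% suc m) (+-comm (toℕ v) (m ∸ toℕ a)))))))

  position-suc : ∀ {u w} → toℕ w ≡ suc (toℕ u) % suc m → u ≢ a → position w ≡ suc (position u)
  position-suc {u} {w} e u≢a = begin
    position w                                  ≡⟨ cong (λ x → (x + (m ∸ toℕ a)) % suc m) e ⟩
    (suc (toℕ u) % suc m + (m ∸ toℕ a)) % suc m ≡⟨ ≈-+ {suc (toℕ u) % suc m} {suc (toℕ u)} {m ∸ toℕ a}
                                                        (≈-mod (suc (toℕ u))) refl ⟩
    suc (toℕ u + (m ∸ toℕ a)) % suc m           ≡⟨ ≈-+ {1} {1} {position u} {toℕ u + (m ∸ toℕ a)}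
                                                        refl (≈-mod (toℕ u + (m ∸ toℕ a))) ⟨
    suc (position u) % suc m                    ≡⟨ m<n⇒m%n≡m (s≤s (≤∧≢⇒< (≤-pred (position<n u)) position≢m)) ⟩
    suc (position u)                            ∎
    where
    open ≡-Reasoning
    position≢m : position u ≢ m
    position≢m p≡m = u≢a (position-injective (trans p≡m (sym position-a)))

module ProperSubgraphOfCycle (m : ℕ) {H : PGraph (suc m)} (H<C : ProperSubgraph H (cycle (suc m))) where
  private
    C : PGraph (suc m)
    C = cycle (suc m)
    H⊆C : Subgraph H C
    H⊆C = proj₁ H<C

  next : Fin (suc m) → Fin (suc m)
  next x = suc (toℕ x) mod suc m

  next-unique : ∀ {u v} → toℕ v ≡ suc (toℕ u) % suc m → v ≡ next u
  next-unique {u} e = toℕ-injective (trans e (sym (toℕ-mod (suc (toℕ u)) (suc m))))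

  edge-H⇒C : ∀ u v → T (edge H u v) → T (edge C u v)
  edge-H⇒C u v uv = proj₁ (proj₁ (proj₂ H⊆C) u v uv)

  edge-sym : ∀ {u v} → T (edge H u v) → T (edge H v u)
  edge-sym {u} {v} = subst T (proj₂ (proj₂ H⊆C) u v)

  missing-edge : ∃ λ a → ¬ T (edge H a (next a))
  missing-edge with all? (λ a → T? (edge H a (next a)))
  ... | no ¬all = ¬∀⟶∃¬ _ _ (λ a → T? (edge H a (next a))) ¬all
  ... | yes all = ⊥-elim (proj₂ H<C (same-vertices , same-edges))
    where
    same-vertices : ∀ v → vert H v ≡ vert C v
    same-vertices v = Equivalence.to T-≡ (proj₁ (proj₂ (proj₁ (proj₂ H⊆C) v (next v) (all v))))
    edge-C⇒H : ∀ u v → T (edge C u v) → T (edge H u v)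
    edge-C⇒H u v uv with cycle-edge⁻ u v uv
    ... | inj₁ fwd = subst (λ w → T (edge H u w)) (sym (next-unique fwd)) (all u)
    ... | inj₂ bwd = edge-sym (subst (λ w → T (edge H v w)) (sym (next-unique bwd)) (all v))
    same-edges : ∀ u v → edge H u v ≡ edge C u v
    same-edges u v = T-ext (edge-H⇒C u v) (edge-C⇒H u v)

  cutVertex : Fin (suc m)
  cutVertex = proj₁ missing-edge
  open Cut m cutVertex

  position-edge : ∀ u v → T (edge H u v) → position v ≡ suc (position u) ⊎ position u ≡ suc (position v)
  position-edge u v uv with cycle-edge⁻ u v (edge-H⇒C u v uv)
  ... | inj₁ fwd = inj₁ (position-suc fwd λ { refl →
                     proj₂ missing-edge (subst (λ w → T (edge H cutVertex w)) (next-unique fwd) uv) })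
  ... | inj₂ bwd = inj₂ (position-suc bwd λ { refl →
                     proj₂ missing-edge (subst (λ w → T (edge H cutVertex w)) (next-unique bwd) (edge-sym uv)) })

  -- Positions stay below n, so computing them modulo 8n loses nothing and makes 8 divide the modulus.
  colouring : ∀ {S} → (∀ c → c < 4 → S c ≤ rulerBound c) → PackingColoring S H (pathColours (suc m))
  colouring S≤bound =
    RulerColouring.rulerColouring H (suc m * 8) (n∣m*n (suc m)) position injective adjacent
      S≤bound (λ v → ruler<pathColours (position<n v))
    where
    open Congruence (suc m * 8) renaming (_≈_ to _≈₈ₙ_)
    below : ∀ v → position v < suc m * 8
    below v = <-≤-trans (position<n v) (m≤m*n (suc m) 8)
    injective : ∀ u v → position u ≈₈ₙ position v → u ≡ v
    injective u v e = position-injective (≈-<-injective (below u) (below v) e)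
    adjacent : ∀ u v → T (edge H u v) → suc (position u) ≈₈ₙ position v ⊎ suc (position v) ≈₈ₙ position u
    adjacent u v uv with position-edge u v uv
    ... | inj₁ fwd = inj₁ (cong (_% (suc m * 8)) (sym fwd))
    ... | inj₂ bwd = inj₂ (cong (_% (suc m * 8)) (sym bwd))

s1247 : ℕ → ℕ
s1247 0 = 1
s1247 1 = 2
s1247 2 = 4
s1247 _ = 7

s1356 : ℕ → ℕ
s1356 0 = 1
s1356 1 = 3
s1356 2 = 5
s1356 _ = 6

-- The exhaustive searches, run by the type checker: in every L-separated 4-colouring of 21
-- consecutive positions (window 7), positions 6 and 14 agree; no such colouring of 2r positions,
-- 0 < r < 8, has period r; the same for C_3, C_5, C_6, C_7 with window n - 1 and pathColours n
-- colours; P_8 has no separated 3-colouring and P_4 no 2-colouring.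
-- This is a product rather than a record, whose positivity check would normalise the searches
-- for an unknown L; for the same reason L is never left to unification against these types.
Certificates : (ℕ → ℕ) → Set
Certificates L =
  T (everyExtension L 7 4 (repeatsAt 6 14) 21 []) ×
  T (allBelow 7 λ r → noSquare L 7 4 (suc r)) ×
  T (noSquare L 2 2 3) × T (noSquare L 4 3 5) × T (noSquare L 5 3 6) × T (noSquare L 6 3 7) ×
  T (noWord L 7 3 8) × T (noWord L 3 2 4)

certificates1247 : Certificates s1247
certificates1247 = tt , tt , tt , tt , tt , tt , tt , tt

certificates1356 : Certificates s1356
certificates1356 = tt , tt , tt , tt , tt , tt , tt , tt

packingSeq-mono : ∀ {S} → PackingSeq S → ∀ {i j} → i ≤ j → S i ≤ S j
packingSeq-mono {S} (_ , nondecreasing) i≤j = go (≤⇒≤′ i≤j)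
  where
  go : ∀ {i j} → i ≤′ j → S i ≤ S j
  go ≤′-refl        = ≤-refl
  go (≤′-step i≤′j) = ≤-trans (go i≤′j) (nondecreasing _)

packingSeq-from : ∀ {S i v} → PackingSeq S → S i ≡ v → ∀ c → v ≤ S (i + c)
packingSeq-from {i = i} seq sᵢ c = ≤-trans (≤-reflexive (sym sᵢ)) (packingSeq-mono seq (m≤m+n i c))

class-lower-bound : ∀ {S} → PackingSeq S → InClasses S → ∃ λ L → Certificates L × (∀ c → L c ≤ S c)
class-lower-bound seq (s₀ , inj₁ (s₁ , 4≤s₂ , _ , s₃)) = s1247 , certificates1247 , λ where
  0                   → ≤-reflexive (sym s₀)
  1                   → ≤-reflexive (sym s₁)
  2                   → 4≤s₂
  (suc (suc (suc c))) → packingSeq-from seq s₃ c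
class-lower-bound seq (s₀ , inj₂ (inj₁ (s₁ , 4≤s₂ , _ , s₃))) = s1247 , certificates1247 , λ where
  0                   → ≤-reflexive (sym s₀)
  1                   → subst (2 ≤_) (sym s₁) (n≤1+n 2)
  2                   → 4≤s₂
  (suc (suc (suc c))) → packingSeq-from seq s₃ c
class-lower-bound seq (s₀ , inj₂ (inj₂ (s₁ , 5≤s₂ , _ , s₃))) = s1356 , certificates1356 , λ where
  0                   → ≤-reflexive (sym s₀)
  1                   → ≤-reflexive (sym s₁)
  2                   → 5≤s₂
  (suc (suc (suc c))) → packingSeq-from seq s₃ c

class-upper-bound : ∀ {S} → InClasses S → ∀ c → c < 4 → S c ≤ rulerBound c
class-upper-bound {S} (s₀ , inj₁ (s₁ , _ , s₂≤7 , s₃)) =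
  first4 {λ c → S c ≤ rulerBound c} (≤-reflexive s₀) (≤-trans (≤-reflexive s₁) (n≤1+n 2)) s₂≤7 (≤-reflexive s₃)
class-upper-bound {S} (s₀ , inj₂ (inj₁ (s₁ , _ , s₂≤7 , s₃))) =
  first4 {λ c → S c ≤ rulerBound c} (≤-reflexive s₀) (≤-reflexive s₁) s₂≤7 (≤-reflexive s₃)
class-upper-bound {S} (s₀ , inj₂ (inj₂ (s₁ , _ , s₂≤6 , s₃))) =
  first4 {λ c → S c ≤ rulerBound c} (≤-reflexive s₀) (≤-reflexive s₁) (≤-trans s₂≤6 (n≤1+n 6))
    (≤-trans (≤-reflexive s₃) (n≤1+n 6))

module LowerBounds {S L : ℕ → ℕ} (L≤S : ∀ c → L c ≤ S c) where

  noSquare⇒¬cycleColouring : ∀ {m} D K {k} → D < suc m → k ≤ K → T (noSquare L D K (suc m)) →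
                              ¬ PackingColoring S (cycle (suc m)) k
  noSquare⇒¬cycleColouring {m} D K D<n k≤K noSq col =
    periodic⇒¬noSquare {L} {D} {K} {suc m} (λ j _ → <-≤-trans (colourAlong<k (_mod suc m) j) k≤K)
      (ψ-separated L≤S D<n (suc m + suc m)) ψ-periodic noSq
    where open CycleColourSequence {S = S} col

  noWord⇒¬pathColouring : ∀ {m} D B K {k} → B ≤ suc m → k ≤ K → T (noWord L D K B) →
                           ¬ PackingColoring S (path (suc m)) k
  noWord⇒¬pathColouring {m} D B K B≤n k≤K none col =
    everyExtension-sound L D K (λ j _ → <-≤-trans (colourAlong<k (_mod suc m) j) k≤K) separated none
    where
    open ColourSequence {S = S} (λ _ → tt) col
    toℕ-small : ∀ {i} → i < B → toℕ (i mod suc m) ≡ i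
    toℕ-small {i} i<B = trans (toℕ-mod i (suc m)) (m<n⇒m%n≡m (<-≤-trans i<B B≤n))
    adjacent : ∀ i → suc i < B → T (edge (path (suc m)) (i mod suc m) (suc i mod suc m))
    adjacent i 1+i<B = Equivalence.from (T-∨ {⌊ toℕ (suc i mod suc m) ≟ suc (toℕ (i mod suc m)) ⌋})
      (inj₁ (fromWitness (trans (toℕ-small 1+i<B) (cong suc (sym (toℕ-small (<-trans (n<1+n i) 1+i<B)))))))
    separated : Separated L D B (colourAlong (_mod suc m))
    separated = colourAlong-separated (_mod suc m) adjacent L≤S
      λ i d 0<d _ i+d<B → mod-distinct (suc m) i d 0<d (≤-<-trans (m≤n+m d i) (<-≤-trans i+d<B B≤n))

  long-cycle-uncolourable : ∀ {m k} → k ≤ 4 → T (everyExtension L 7 4 (repeatsAt 6 14) 21 []) →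
                            T (allBelow 7 λ r → noSquare L 7 4 (suc r)) → ¬ 8 ∣ 9 + m →
                            ¬ PackingColoring S (cycle (9 + m)) k
  long-cycle-uncolourable {m} k≤4 period8 squareFree 8∤n col = aperiodic ((9 + m) % 8) refl
    where
    open CycleColourSequence {8 + m} {S} col
    colour<4 : ∀ j → ψ j < 4
    colour<4 j = <-≤-trans (colourAlong<k (_mod (9 + m)) j) k≤4
    separated : ∀ B → Separated L 7 B ψ
    separated = ψ-separated L≤S (m≤m+n 8 (suc m))
    window : ∀ i → ψ (i + 14) ≡ ψ (i + 6)
    window i = just-injective (toWitness {a? = ≡-decᴹ _≟_ (head (drop 6 w)) (head (drop 14 w))}
      (everyExtension-sound L 7 4 {21} {λ e → ψ (i + e)} (λ j _ → colour<4 (i + j))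
         (separated-shift {L} {7} {21} i (separated (i + 21))) {repeatsAt 6 14} period8))
      where
      w : List ℕ
      w = applyDownFrom (λ e → ψ (i + e)) 21
    ψ-period8 : HasPeriod 8 ψ
    ψ-period8 = hasPeriod-from {6} {3 + m} ψ-periodic λ i → trans (cong ψ (+-assoc i 6 8)) (window i)
    aperiodic : ∀ r → (9 + m) % 8 ≡ r → ⊥
    aperiodic zero    r≡0 = 8∤n (m%n≡0⇒n∣m (9 + m) 8 r≡0)
    aperiodic (suc r) r≡  =
      periodic⇒¬noSquare {L} {7} {4} {suc r} (λ j _ → colour<4 j) (separated _)
        (subst (λ p → HasPeriod p ψ) r≡ (hasPeriod-% ψ-period8 ψ-periodic))
        (allBelow-sound {7} {λ r → noSquare L 7 4 (suc r)} squareFree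
          (≤-pred (subst (_< 8) r≡ (m%n<n (9 + m) 8))))

  cycle-lower-bound : ∀ {m k} → Certificates L → ¬ 8 ∣ 3 + m → 3 + m ≢ 4 → k ≤ pathColours (3 + m) →
                      ¬ PackingColoring S (cycle (3 + m)) k
  cycle-lower-bound {0} (_ , _ , cycle3 , _) _ _ k≤ = noSquare⇒¬cycleColouring 2 2 ≤-refl k≤ cycle3
  cycle-lower-bound {1} _ _ 4≢4 _ = ⊥-elim (4≢4 refl)
  cycle-lower-bound {2} (_ , _ , _ , cycle5 , _) _ _ k≤ = noSquare⇒¬cycleColouring 4 3 ≤-refl k≤ cycle5
  cycle-lower-bound {3} (_ , _ , _ , _ , cycle6 , _) _ _ k≤ = noSquare⇒¬cycleColouring 5 3 ≤-refl k≤ cycle6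
  cycle-lower-bound {4} (_ , _ , _ , _ , _ , cycle7 , _) _ _ k≤ = noSquare⇒¬cycleColouring 6 3 ≤-refl k≤ cycle7
  cycle-lower-bound {5} _ 8∤8 _ _ = ⊥-elim (8∤8 (divides 1 refl))
  cycle-lower-bound {suc (suc (suc (suc (suc (suc m)))))} (period8 , squareFree , _) 8∤n _ k≤4 =
    long-cycle-uncolourable k≤4 period8 squareFree 8∤n

  8∣n⇒¬critical : ∀ {m} → Certificates L → (∀ c → c < 4 → S c ≤ rulerBound c) → 8 ∣ 3 + m →
                  ¬ Critical S (cycle (3 + m))
  8∣n⇒¬critical {m} (_ , _ , _ , _ , _ , _ , path8 , _) S≤bound 8∣n =
    tightSubgraph⇒¬critical {S = S} (path-proper m) (cycle-rulerColouring {S = S} S≤bound 8∣n)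
      λ j j<4 → noWord⇒¬pathColouring 7 8 3 (∣⇒≤ 8∣n) (≤-pred j<4) path8

  C₄-¬critical : Certificates L → S 0 ≡ 1 → ¬ Critical S (cycle 4)
  C₄-¬critical (_ , _ , _ , _ , _ , _ , _ , path4) s₀ =
    tightSubgraph⇒¬critical {S = S} (path-proper 1) (c4-colouring {S} s₀)
      λ j j<3 → noWord⇒¬pathColouring 3 4 2 ≤-refl (≤-pred j<3) path4

  critical⇔ : ∀ {m} → Certificates L → InClasses S →
              Critical S (cycle (3 + m)) ⇔ ((¬ (8 ∣ 3 + m)) × 3 + m ≢ 4)
  critical⇔ {m} certificates classes = mk⇔
    (λ crit → (λ 8∣n → 8∣n⇒¬critical certificates S≤bound 8∣n crit) ,
              (λ { refl → C₄-¬critical certificates (proj₁ classes) crit }))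
    (λ (8∤n , n≢4) → colourGap⇒critical {S = S}
       (λ H H<C → ProperSubgraphOfCycle.colouring (2 + m) H<C S≤bound)
       (λ k k≤ → cycle-lower-bound certificates 8∤n n≢4 k≤))
    where
    S≤bound : ∀ c → c < 4 → S c ≤ rulerBound c
    S≤bound = class-upper-bound classes

theorem4p3 : (n : ℕ) → 3 ≤ n → (S : ℕ → ℕ) → PackingSeq S → InClasses S →
    Critical S (cycle n) ⇔ ((¬ (8 ∣ n)) × n ≢ 4)
theorem4p3 (suc (suc (suc m))) _ S seq classes =
  let L , certificates , L≤S = class-lower-bound seq classes
  in LowerBounds.critical⇔ {S} {L} L≤S certificates classes
theorem4p3 1 (s≤s ())
theorem4p3 2 (s≤s (s≤s ()))
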